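{- Let $D$ be a digraph such that every proper induced subdigraph of $D$ satisfies the BE-property (resp. the $\alpha$-property). Let $S$ be a maximum stable set of $D$ and let $P=v_1v_2\dots v_k$ be a path of $D$ with $V(P)\cap S=\emptyset$. If there is a vertex $u\in V(D)\setminus V(P)$ with $u\notin S$, $N^+(u)\neq\emptyset$ and $N^+(u)\subseteq V(P)$, then $D$ admits an $S_{BE}$-path partition (resp. an $S$-path partition).
   Context: Digraphs are finite, loopless, without multiple arcs (digons allowed). $N^+(u)$ is the set of out-neighbours of $u$. A stable set is a set of pairwise non-adjacent vertices. A path partition is a collection of vertex-disjoint (directed) paths covering $V(D)$. For a stable set $S$, an $S$-path partition is a path partition in which each path contains exactly one vertex of $S$; an $S_{BE}$-path partition is an $S$-path partition in which additionally every vertex of $S$ is the first or last vertex of its path. A digraph satisfies the $\alpha$-property (resp. BE-property) if for every maximum stable set $S$ it admits an $S$-path partition (resp. $S_{BE}$-path partition). -}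

module Defs where

open import Data.Nat using (ℕ; _≤_)
open import Data.Bool using (Bool; true; false)
open import Data.Fin using (Fin)
open import Data.Fin.Subset using (Subset; _∈_; _∉_; _⊆_; ∣_∣; ⊤)
open import Data.List using (List; []; _∷_; concatMap)
open import Data.List.Membership.Propositional renaming (_∈_ to _∈ₗ_; _∉_ to _∉ₗ_)
open import Data.List.Relation.Unary.Unique.Propositional using (Unique)
open import Data.List.Relation.Unary.Linked using (Linked)
open import Data.List.Relation.Unary.All using (All)
open import Data.Product using (Σ; ∃; _×_)
open import Data.Sum using (_⊎_)
open import Relation.Binary.PropositionalEquality using (_≡_)
open import Relation.Nullary using (¬_)

-- A digraph on vertex set Fin n: arc relation given as a Bool matrix,
-- loopless; digons allowed; no multiple arcs (by construction).
record Digraph : Set where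
  field
    n        : ℕ
    arc      : Fin n → Fin n → Bool
    loopless : ∀ v → arc v v ≡ false

module _ (D : Digraph) where
  open Digraph D

  Vertex : Set
  Vertex = Fin n

  Arc : Vertex → Vertex → Set
  Arc u v = arc u v ≡ true

  IsPath : List Vertex → Set
  IsPath p = Unique p × Linked Arc p

  lastOf : Vertex → List Vertex → Vertex
  lastOf x []       = x
  lastOf x (y ∷ ys) = lastOf y ys

  IsStableIn : Subset n → Subset n → Set
  IsStableIn X S = S ⊆ X × (∀ u v → u ∈ S → v ∈ S → ¬ Arc u v)

  IsMaxStableIn : Subset n → Subset n → Set
  IsMaxStableIn X S = IsStableIn X S × (∀ T → IsStableIn X T → ∣ T ∣ ≤ ∣ S ∣)

  record NEPath : Set where
    constructor mkPath
    field
      first : Vertex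
      rest  : List Vertex
      isPath : IsPath (first ∷ rest)

  verts : NEPath → List Vertex
  verts P = NEPath.first P ∷ NEPath.rest P

  IsPathPartitionOf : Subset n → List NEPath → Set
  IsPathPartitionOf X ps =
    Unique (concatMap verts ps) × (∀ v → (v ∈ X → v ∈ₗ concatMap verts ps)
                                       × (v ∈ₗ concatMap verts ps → v ∈ X))

  ExactlyOneIn : Subset n → NEPath → Set
  ExactlyOneIn S P = ∃ λ s → s ∈ₗ verts P × s ∈ S
                               × (∀ t → t ∈ₗ verts P → t ∈ S → t ≡ s)

  EndInS : Subset n → NEPath → Set
  EndInS S P = NEPath.first P ∈ S ⊎ lastOf (NEPath.first P) (NEPath.rest P) ∈ S

  IsSPathPartitionOf : Subset n → Subset n → List NEPath → Set
  IsSPathPartitionOf X S ps = IsPathPartitionOf X ps × All (ExactlyOneIn S) ps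

  IsSBEPathPartitionOf : Subset n → Subset n → List NEPath → Set
  IsSBEPathPartitionOf X S ps =
    IsSPathPartitionOf X S ps × All (EndInS S) ps

  AlphaPropertyOn : Subset n → Set
  AlphaPropertyOn X = ∀ S → IsMaxStableIn X S → ∃ λ ps → IsSPathPartitionOf X S ps

  BEPropertyOn : Subset n → Set
  BEPropertyOn X = ∀ S → IsMaxStableIn X S → ∃ λ ps → IsSBEPathPartitionOf X S ps

  Proper : Subset n → Set
  Proper X = ∃ λ v → v ∉ X

  LemmaHyp : Subset n → NEPath → Vertex → Set
  LemmaHyp S P u =
      (∀ v → v ∈ₗ verts P → v ∉ S)
    × u ∉ₗ verts P
    × u ∉ S
    × (∃ λ w → Arc u w)
    × (∀ w → Arc u w → w ∈ₗ verts P)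

-- Let w be the first out-neighbour of u on P and R the subpath of P starting at w.
-- Deleting R leaves a proper induced subdigraph D[X] in which S is still a maximum
-- stable set (R avoids S), so D[X] has an S-path partition.  Every out-neighbour of u
-- lies in R, because those on P before w are excluded by the choice of w; hence u is a
-- sink of D[X] and ends its path Q.  Appending R to Q gives an S-path partition of D;
-- since u ∉ S, the S-vertex of Q was its first vertex, so the BE-condition survives.
module Submission where

open import Defs
open import Data.Bool using (true)
open import Data.Bool.Properties using () renaming (_≟_ to _≟ᵇ_)
open import Data.Empty using (⊥-elim)
open import Data.Fin using (Fin)
open import Data.Fin.Subset using (Subset; _∈_; _∉_; _⊆_; ⊤; ⁅_⁆; ⋃; ∁)
open import Data.Fin.Subset.Properties
  using (∈⊤; ∉⊥; x∈⁅x⁆; x∈⁅y⁆⇒x≡y; x∈p∪q⁺; x∈p∪q⁻; x∉p⇒x∈∁p; x∈∁p⇒x∉p; _∈?_)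
open import Data.List using (List; []; _∷_; _++_; concatMap; map; last)
open import Data.List.Properties using (++-assoc; concatMap-++)
open import Data.List.Membership.Propositional using (find; lose) renaming (_∈_ to _∈ₗ_; _∉_ to _∉ₗ_)
open import Data.List.Membership.Propositional.Properties using (∈-++⁺ˡ; ∈-++⁺ʳ; ∈-++⁻; ∈-∃++; ∈-concatMap⁺; ∈-concatMap⁻)
open import Data.List.Relation.Binary.Disjoint.Propositional using (Disjoint)
open import Data.List.Relation.Binary.Permutation.Propositional using (_↭_; ↭-sym; ↭⇒↭ₛ; module PermutationReasoning)
open import Data.List.Relation.Binary.Permutation.Propositional.Properties using (shifts; ∈-resp-↭)
open import Data.List.Relation.Binary.Permutation.Setoid.Properties using (Unique-resp-↭)
open import Data.List.Relation.Unary.All as All using (All; []; _∷_)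
open import Data.List.Relation.Unary.AllPairs using (_∷_)
open import Data.List.Relation.Unary.Any as Any using (Any; here; there)
open import Data.List.Relation.Unary.Linked as Linked using (Linked; _∷_)
import Data.List.Relation.Unary.Linked.Properties as Linked
open import Data.List.Relation.Unary.Unique.Propositional using (Unique)
import Data.List.Relation.Unary.Unique.Propositional.Properties as Unique
open import Data.Maybe using (just)
open import Data.Maybe.Relation.Binary.Connected using (Connected; just)
open import Data.Product using (∃; ∃₂; _×_; _,_; proj₁; proj₂)
open import Data.Sum using (_⊎_; inj₁; inj₂; [_,_]′)
open import Function using (_∘_; _⇔_; mk⇔; Equivalence)
open import Relation.Binary.PropositionalEquality using (_≡_; refl; sym; cong; subst; setoid)
open import Relation.Nullary using (¬_; yes; no)
open import Relation.Unary using (Pred; Decidable)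

open NEPath using (first; rest; isPath)

module _ {a} {A : Set a} where

  firstSplit : ∀ {p} {P : Pred A p} → Decidable P → ∀ {xs} → Any P xs →
               ∃₂ λ ys zs → ∃ λ y → xs ≡ ys ++ y ∷ zs × All (¬_ ∘ P) ys × P y
  firstSplit P? {x ∷ xs} any with P? x
  ... | yes px = [] , xs , x , refl , [] , px
  ... | no ¬px with firstSplit P? (Any.tail ¬px any)
  ...   | ys , zs , y , refl , ¬Pys , py = x ∷ ys , zs , y , refl , ¬px ∷ ¬Pys , py

  All-replace : ∀ {p} {P : Pred A p} ys {x x′ zs} → (P x → P x′) →
                All P (ys ++ x ∷ zs) → All P (ys ++ x′ ∷ zs)
  All-replace []       f (px ∷ pzs) = f px ∷ pzs
  All-replace (y ∷ ys) f (py ∷ pys) = py ∷ All-replace ys f pys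

  concatMap-extend : ∀ {b} {B : Set b} (f : A → List B) ys {x x′ zs bs} →
                     f x′ ≡ f x ++ bs →
                     concatMap f (ys ++ x′ ∷ zs) ↭ bs ++ concatMap f (ys ++ x ∷ zs)
  concatMap-extend {B = B} f ys {x} {x′} {zs} {bs} fx′≡fx++bs = begin
    concatMap f (ys ++ x′ ∷ zs)   ≡⟨ concatMap-++ f ys (x′ ∷ zs) ⟩
    F ys ++ f x′ ++ F zs          ≡⟨ cong (λ l → F ys ++ l ++ F zs) fx′≡fx++bs ⟩
    F ys ++ (f x ++ bs) ++ F zs   ≡⟨ cong (F ys ++_) (++-assoc (f x) bs (F zs)) ⟩
    F ys ++ f x ++ bs ++ F zs     ≡⟨ ++-assoc (F ys) (f x) (bs ++ F zs) ⟨
    (F ys ++ f x) ++ bs ++ F zs   ↭⟨ shifts (F ys ++ f x) bs ⟩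
    bs ++ (F ys ++ f x) ++ F zs   ≡⟨ cong (bs ++_) (++-assoc (F ys) (f x) (F zs)) ⟩
    bs ++ F ys ++ f x ++ F zs     ≡⟨ cong (bs ++_) (concatMap-++ f ys (x ∷ zs)) ⟨
    bs ++ concatMap f (ys ++ x ∷ zs) ∎
    where
    open PermutationReasoning
    F : List A → List B
    F = concatMap f

fromList : ∀ {n} → List (Fin n) → Subset n
fromList xs = ⋃ (map ⁅_⁆ xs)

module _ {n} {v : Fin n} where

  ∈-fromList⁺ : ∀ {xs} → v ∈ₗ xs → v ∈ fromList xs
  ∈-fromList⁺ (here refl) = x∈p∪q⁺ (inj₁ (x∈⁅x⁆ v))
  ∈-fromList⁺ (there v∈) = x∈p∪q⁺ (inj₂ (∈-fromList⁺ v∈))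

  ∈-fromList⁻ : ∀ xs → v ∈ fromList xs → v ∈ₗ xs
  ∈-fromList⁻ []       v∈ = ⊥-elim (∉⊥ v∈)
  ∈-fromList⁻ (x ∷ xs) v∈ with x∈p∪q⁻ ⁅ x ⁆ (fromList xs) v∈
  ... | inj₁ v∈⁅x⁆ = here (x∈⁅y⁆⇒x≡y x v∈⁅x⁆)
  ... | inj₂ v∈xs  = there (∈-fromList⁻ xs v∈xs)

  ∈∁fromList⁺ : ∀ xs → v ∉ₗ xs → v ∈ ∁ (fromList xs)
  ∈∁fromList⁺ xs v∉ = x∉p⇒x∈∁p (v∉ ∘ ∈-fromList⁻ xs)

  ∈∁fromList⁻ : ∀ xs → v ∈ ∁ (fromList xs) → v ∉ₗ xs
  ∈∁fromList⁻ _ v∈ = x∈∁p⇒x∉p v∈ ∘ ∈-fromList⁺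

  ∈∁fromList⊎∈ : ∀ xs → v ∈ ∁ (fromList xs) ⊎ v ∈ₗ xs
  ∈∁fromList⊎∈ xs with v ∈? fromList xs
  ... | yes v∈ = inj₂ (∈-fromList⁻ xs v∈)
  ... | no  v∉ = inj₁ (x∉p⇒x∈∁p v∉)

module _ (D : Digraph) where

  private
    V : Set
    V = Vertex D

  Arc? : (u : V) → Decidable (Arc D u)
  Arc? u v = Digraph.arc D u v ≟ᵇ true

  lastVertex : NEPath D → V
  lastVertex Q = lastOf D (first Q) (rest Q)

  IsPath-++⁻ʳ : ∀ xs {ys} → IsPath D (xs ++ ys) → IsPath D ys
  IsPath-++⁻ʳ []       p = p
  IsPath-++⁻ʳ (x ∷ xs) (_ ∷ unique , linked) = IsPath-++⁻ʳ xs (unique , Linked.tail linked)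

  Connected-last : ∀ x xs {y} → Arc D (lastOf D x xs) y → Connected (Arc D) (last (x ∷ xs)) (just y)
  Connected-last x []       a = just a
  Connected-last x (z ∷ zs) a = Connected-last z zs a

  lastOf-sink : ∀ {u} x xs → Linked (Arc D) (x ∷ xs) → u ∈ₗ x ∷ xs →
                (∀ {y} → y ∈ₗ xs → ¬ Arc D u y) → lastOf D x xs ≡ u
  lastOf-sink x []       _         (here refl) _    = refl
  lastOf-sink x []       _         (there ())
  lastOf-sink x (y ∷ ys) (x→y ∷ _) (here refl) sink = ⊥-elim (sink (here refl) x→y)
  lastOf-sink x (y ∷ ys) (_ ∷ linked) (there u∈) sink = lastOf-sink y ys linked u∈ (sink ∘ there)

  -- Not pattern matching on Q keeps verts (appendPath Q R a d) ≡ verts Q ++ verts R definitional.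
  appendPath : (Q R : NEPath D) → Arc D (lastVertex Q) (first R) →
               Disjoint (verts D Q) (verts D R) → NEPath D
  appendPath Q R a disjoint =
    mkPath (first Q) (rest Q ++ verts D R)
      ( Unique.++⁺ (proj₁ (isPath Q)) (proj₁ (isPath R)) disjoint
      , Linked.++⁺ (proj₂ (isPath Q)) (Connected-last (first Q) (rest Q) a)
                   (proj₂ (isPath R)))

  module _ (Q R : NEPath D) (a : Arc D (lastVertex Q) (first R))
           (disjoint : Disjoint (verts D Q) (verts D R)) {S : Subset (Digraph.n D)} where

    ExactlyOneIn-appendPath : (∀ {v} → v ∈ₗ verts D R → v ∉ S) →
                              ExactlyOneIn D S Q → ExactlyOneIn D S (appendPath Q R a disjoint)
    ExactlyOneIn-appendPath R∩S=∅ (s , s∈Q , s∈S , unique) =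
      s , ∈-++⁺ˡ s∈Q , s∈S ,
      λ t t∈ t∈S → [ (λ t∈Q → unique t t∈Q t∈S) , (λ t∈R → ⊥-elim (R∩S=∅ t∈R t∈S)) ]′
                     (∈-++⁻ (verts D Q) t∈)

    EndInS-appendPath : lastVertex Q ∉ S → EndInS D S Q → EndInS D S (appendPath Q R a disjoint)
    EndInS-appendPath _      (inj₁ first∈S) = inj₁ first∈S
    EndInS-appendPath last∉S (inj₂ last∈S)  = ⊥-elim (last∉S last∈S)

  IsPathPartitionOf-extend : ∀ {X Y} ys {zs Q Q′ bs} → IsPathPartitionOf D X (ys ++ Q ∷ zs) →
                             verts D Q′ ≡ verts D Q ++ bs → Unique bs →
                             (∀ {v} → v ∈ₗ bs → v ∉ X) → (∀ v → v ∈ Y ⇔ (v ∈ X ⊎ v ∈ₗ bs)) →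
                             IsPathPartitionOf D Y (ys ++ Q′ ∷ zs)
  IsPathPartitionOf-extend {Y = Y} ys {zs} {Q} {Q′} {bs} (unique , covers) Q′≡Q++bs unique-bs bs∩X=∅ Y⇔ =
    Unique-resp-↭ (setoid V) (↭⇒↭ₛ (↭-sym perm)) (Unique.++⁺ unique-bs unique disjoint) ,
    λ v → into , outOf
    where
    perm : concatMap (verts D) (ys ++ Q′ ∷ zs) ↭ bs ++ concatMap (verts D) (ys ++ Q ∷ zs)
    perm = concatMap-extend (verts D) ys Q′≡Q++bs

    disjoint : Disjoint bs (concatMap (verts D) (ys ++ Q ∷ zs))
    disjoint (v∈bs , v∈ps) = bs∩X=∅ v∈bs (proj₂ (covers _) v∈ps)

    into : ∀ {v} → v ∈ Y → v ∈ₗ concatMap (verts D) (ys ++ Q′ ∷ zs)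
    into {v} v∈Y = ∈-resp-↭ (↭-sym perm)
      ([ (λ v∈X → ∈-++⁺ʳ bs (proj₁ (covers v) v∈X)) , ∈-++⁺ˡ ]′ (Equivalence.to (Y⇔ v) v∈Y))

    outOf : ∀ {v} → v ∈ₗ concatMap (verts D) (ys ++ Q′ ∷ zs) → v ∈ Y
    outOf {v} v∈ = Equivalence.from (Y⇔ v)
      ([ inj₂ , inj₁ ∘ proj₂ (covers v) ]′ (∈-++⁻ bs (∈-resp-↭ perm v∈)))

  attachPath : ∀ {X Y S ps u} → IsSPathPartitionOf D X S ps → (R : NEPath D) →
               (∀ {v} → v ∈ₗ verts D R → v ∉ X) → (∀ {v} → v ∈ₗ verts D R → v ∉ S) →
               (∀ v → v ∈ Y ⇔ (v ∈ X ⊎ v ∈ₗ verts D R)) →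
               u ∈ X → Arc D u (first R) → (∀ {v} → v ∈ X → ¬ Arc D u v) →
               ∃ λ ps′ → IsSPathPartitionOf D Y S ps′
                         × (u ∉ S → All (EndInS D S) ps → All (EndInS D S) ps′)
  attachPath {X} {S = S} {ps} {u} (part , exactlyOne) R R∩X=∅ R∩S=∅ Y⇔ u∈X u→R u-sink
    with find (∈-concatMap⁻ (verts D) {xs = ps} (proj₁ (proj₂ part u) u∈X))
  ... | Q , Q∈ps , u∈Q with ∈-∃++ Q∈ps
  ... | ys , zs , refl =
    ys ++ Q′ ∷ zs ,
    ( IsPathPartitionOf-extend ys part refl (proj₁ (isPath R)) R∩X=∅ Y⇔
    , All-replace ys (ExactlyOneIn-appendPath Q R last→R disjoint R∩S=∅) exactlyOne ) ,
    λ u∉S → All-replace ys (EndInS-appendPath Q R last→R disjoint (subst (_∉ S) (sym last≡u) u∉S))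
    where
    Q⊆X : ∀ {v} → v ∈ₗ verts D Q → v ∈ X
    Q⊆X v∈Q = proj₂ (proj₂ part _) (∈-concatMap⁺ (verts D) (lose Q∈ps v∈Q))

    last≡u : lastVertex Q ≡ u
    last≡u = lastOf-sink _ _ (proj₂ (isPath Q)) u∈Q (λ y∈ → u-sink (Q⊆X (there y∈)))

    last→R : Arc D (lastVertex Q) (first R)
    last→R = subst (λ x → Arc D x (first R)) (sym last≡u) u→R

    disjoint : Disjoint (verts D Q) (verts D R)
    disjoint (v∈Q , v∈R) = R∩X=∅ v∈R (Q⊆X v∈Q)

    Q′ : NEPath D
    Q′ = appendPath Q R last→R disjoint

  IsMaxStableIn-restrict : ∀ {X Y S} → X ⊆ Y → S ⊆ X → IsMaxStableIn D Y S → IsMaxStableIn D X S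
  IsMaxStableIn-restrict X⊆Y S⊆X ((_ , stable) , maximum) =
    (S⊆X , stable) , λ T (T⊆X , T-stable) → maximum T (X⊆Y ∘ T⊆X , T-stable)

  record Reduction (S : Subset (Digraph.n D)) : Set where
    field
      X           : Subset (Digraph.n D)
      X-proper    : Proper D X
      S-maxStable : IsMaxStableIn D X S
      lift        : ∀ {ps} → IsSPathPartitionOf D X S ps → ∃ (IsSPathPartitionOf D ⊤ S)
      liftBE      : ∀ {ps} → IsSBEPathPartitionOf D X S ps → ∃ (IsSBEPathPartitionOf D ⊤ S)

  reduction : ∀ {S} → IsMaxStableIn D ⊤ S → ∀ P u → LemmaHyp D S P u → Reduction S
  reduction {S} maxS P u (P∩S=∅ , u∉P , u∉S , (w , u→w) , N⁺u⊆P)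
    with firstSplit (Arc? u) (lose (N⁺u⊆P w u→w) u→w)
  ... | A , B , r , P≡A++R , A↛ , u→r = record
    { X           = X
    ; X-proper    = r , λ r∈X → ∈∁fromList⁻ (verts D R) r∈X (here refl)
    ; S-maxStable = IsMaxStableIn-restrict (λ _ → ∈⊤) S⊆X maxS
    ; lift        = λ part → let ps′ , part′ , _ = attach part in ps′ , part′
    ; liftBE      = λ (part , ends) → let ps′ , part′ , ends′ = attach part in
                                      ps′ , part′ , ends′ u∉S ends
    }
    where
    R : NEPath D
    R = mkPath r B (IsPath-++⁻ʳ A (subst (IsPath D) P≡A++R (isPath P)))

    R⊆P : ∀ {v} → v ∈ₗ verts D R → v ∈ₗ verts D P
    R⊆P v∈R = subst (_ ∈ₗ_) (sym P≡A++R) (∈-++⁺ʳ A v∈R)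

    X : Subset (Digraph.n D)
    X = ∁ (fromList (verts D R))

    R∩S=∅ : ∀ {v} → v ∈ₗ verts D R → v ∉ S
    R∩S=∅ = P∩S=∅ _ ∘ R⊆P

    S⊆X : S ⊆ X
    S⊆X v∈S = ∈∁fromList⁺ (verts D R) (λ v∈R → R∩S=∅ v∈R v∈S)

    u-sink : ∀ {v} → v ∈ X → ¬ Arc D u v
    u-sink {v} v∈X u→v with ∈-++⁻ A (subst (v ∈ₗ_) P≡A++R (N⁺u⊆P v u→v))
    ... | inj₁ v∈A = All.lookup A↛ v∈A u→v
    ... | inj₂ v∈R = ∈∁fromList⁻ (verts D R) v∈X v∈R

    attach : ∀ {ps} → IsSPathPartitionOf D X S ps →
             ∃ λ ps′ → IsSPathPartitionOf D ⊤ S ps′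
                       × (u ∉ S → All (EndInS D S) ps → All (EndInS D S) ps′)
    attach part = attachPath part R (λ v∈R v∈X → ∈∁fromList⁻ (verts D R) v∈X v∈R) R∩S=∅
      (λ _ → mk⇔ (λ _ → ∈∁fromList⊎∈ (verts D R)) (λ _ → ∈⊤))
      (∈∁fromList⁺ (verts D R) (u∉P ∘ R⊆P)) u→r u-sink

lemma1 : (D : Digraph)
    → ((∀ X → Proper D X → BEPropertyOn D X)
       → ∀ S → IsMaxStableIn D ⊤ S → ∀ P u → LemmaHyp D S P u
       → ∃ λ ps → IsSBEPathPartitionOf D ⊤ S ps)
    × ((∀ X → Proper D X → AlphaPropertyOn D X)
       → ∀ S → IsMaxStableIn D ⊤ S → ∀ P u → LemmaHyp D S P u
       → ∃ λ ps → IsSPathPartitionOf D ⊤ S ps)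
lemma1 D =
  (λ BE S maxS P u hyp → let open Reduction (reduction D maxS P u hyp) in
                         liftBE (proj₂ (BE X X-proper S S-maxStable))) ,
  (λ α S maxS P u hyp → let open Reduction (reduction D maxS P u hyp) in
                        lift (proj₂ (α X X-proper S S-maxStable)))
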